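{- For any simple disjunction $G$ and any interpretations $I$ and $J$: $J\models FT(G,I)$ if and only if $I\models FT(G,I)^{I\setminus J}_\bot$.
   Context: Infinitary propositional formulas: atoms, arbitrary conjunctions $\mathcal H^\land$, disjunctions $\mathcal H^\lor$, implications; $\top=\emptyset^\land$, $\bot=\emptyset^\lor$, $\neg F=F\to\bot$; interpretations are sets of atoms with the usual satisfaction. FT-reduct: $FT(p,I)=p$ if $p\in I$, else $\bot$; $FT(\mathcal H^\land,I)=\{FT(F,I):F\in\mathcal H\}^\land$, likewise for $\lor$; $FT(F\to F',I)=\bot$ if $I\not\models F\to F'$, else $FT(F,I)\to FT(F',I)$. Extended literals: $p,\neg p,\neg\neg p$; a simple disjunction is a disjunction of extended literals. For a set $X$ of atoms and a disjunction $F$, $F^X_\bot$ is obtained by removing from $F$ all disjunctive terms that are atoms belonging to $X$ (so $FT(G,I)^X_\bot$ is the disjunction of the reducts $FT(L,I)$ of the disjunctive terms $L$ of $G$, with those reducts that are atoms of $X$ removed). -}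

module Defs where

open import Data.Bool using (Bool; true; false; _∧_; not)
open import Data.Empty renaming (⊥ to Empty)
open import Data.Product using (Σ; _×_; proj₁)
open import Relation.Binary.PropositionalEquality using (_≡_)
open import Relation.Nullary using (¬_)

-- Infinitary propositional formulas over a type A of atoms.
-- A conjunction / disjunction of a set H of formulas is represented by an
-- arbitrary index type K and a family K → Formula A.
data Formula (A : Set) : Set₁ where
  atom : A → Formula A
  ⋀    : (K : Set) → (K → Formula A) → Formula A
  ⋁    : (K : Set) → (K → Formula A) → Formula A
  _⇒_  : Formula A → Formula A → Formula A

infixr 5 _⇒_

module _ {A : Set} where

  ⊤F : Formula A
  ⊤F = ⋀ Empty ⊥-elim

  ⊥F : Formula A
  ⊥F = ⋁ Empty ⊥-elim

  ¬F : Formula A → Formula A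
  ¬F F = F ⇒ ⊥F

Interp : Set → Set
Interp A = A → Bool

module _ {A : Set} where

  _∖_ : Interp A → Interp A → Interp A
  (I ∖ J) p = I p ∧ not (J p)

  _⊨_ : Interp A → Formula A → Set
  I ⊨ atom p  = I p ≡ true
  I ⊨ ⋀ K H   = (k : K) → I ⊨ H k
  I ⊨ ⋁ K H   = Σ K (λ k → I ⊨ H k)
  I ⊨ (F ⇒ G) = I ⊨ F → I ⊨ G

  -- The FT-reduct FT(F , I), given as its graph: FT F I R means FT(F,I) = R.
  data FT : Formula A → Interp A → Formula A → Set₁ where
    ft-atom-in  : ∀ {I p} → I p ≡ true  → FT (atom p) I (atom p)
    ft-atom-out : ∀ {I p} → I p ≡ false → FT (atom p) I ⊥F
    ft-and : ∀ {I K} {H R : K → Formula A} →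
             ((k : K) → FT (H k) I (R k)) → FT (⋀ K H) I (⋀ K R)
    ft-or  : ∀ {I K} {H R : K → Formula A} →
             ((k : K) → FT (H k) I (R k)) → FT (⋁ K H) I (⋁ K R)
    ft-imp-false : ∀ {I F F'} → ¬ (I ⊨ (F ⇒ F')) → FT (F ⇒ F') I ⊥F
    ft-imp-true  : ∀ {I F F' R R'} → I ⊨ (F ⇒ F') →
                   FT F I R → FT F' I R' → FT (F ⇒ F') I (R ⇒ R')

  data ExtendedLiteral : Formula A → Set where
    lit-pos    : (p : A) → ExtendedLiteral (atom p)
    lit-neg    : (p : A) → ExtendedLiteral (¬F (atom p))
    lit-negneg : (p : A) → ExtendedLiteral (¬F (¬F (atom p)))

  data SimpleDisjunction : Formula A → Set₁ where
    simple : (K : Set) (L : K → Formula A) →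
             ((k : K) → ExtendedLiteral (L k)) → SimpleDisjunction (⋁ K L)

  data AtomIn (X : Interp A) : Formula A → Set where
    atom-in : (p : A) → X p ≡ true → AtomIn X (atom p)

  -- F^X_⊥ for a disjunction F: remove the disjunctive terms that are atoms of X.
  -- (Only meaningful on disjunctions; other formulas are left unchanged.)
  _^_⊥ : Formula A → Interp A → Formula A
  (⋁ K H) ^ X ⊥ = ⋁ (Σ K (λ k → ¬ AtomIn X (H k))) (λ k → H (proj₁ k))
  F ^ X ⊥ = F

module Submission where

-- The reduct of an extended literal is either an atom of I or contains no
-- atoms at all; an atom-free formula has the same truth value in every
-- interpretation, while an atom p ∈ I is dropped from FT(G,I)^{I∖J}_⊥
-- exactly when J ⊭ p.

open import Defs
open import Data.Bool using (true; false)
open import Data.Empty using (⊥-elim)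
open import Data.Product using (_×_; _,_)
open import Function.Bundles using (_⇔_; mk⇔; module Equivalence)
open import Relation.Binary.PropositionalEquality using (_≡_; refl)
open import Relation.Nullary using (¬_)

module _ {A : Set} where

  data AtomFree : Formula A → Set₁ where
    ⋀-atomFree : ∀ {K} {H : K → Formula A} → ((k : K) → AtomFree (H k)) → AtomFree (⋀ K H)
    ⋁-atomFree : ∀ {K} {H : K → Formula A} → ((k : K) → AtomFree (H k)) → AtomFree (⋁ K H)
    ⇒-atomFree : ∀ {F F'} → AtomFree F → AtomFree F' → AtomFree (F ⇒ F')

  atomFree-⊨ : ∀ {F} → AtomFree F → (I J : Interp A) → I ⊨ F → J ⊨ F
  atomFree-⊨ (⋀-atomFree free) I J I⊨H k = atomFree-⊨ (free k) I J (I⊨H k)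
  atomFree-⊨ (⋁-atomFree free) I J (k , I⊨Hk) = k , atomFree-⊨ (free k) I J I⊨Hk
  atomFree-⊨ (⇒-atomFree freeF freeF') I J I⊨F⇒F' J⊨F =
    atomFree-⊨ freeF' I J (I⊨F⇒F' (atomFree-⊨ freeF J I J⊨F))

  atomFree-⇔ : ∀ {F} → AtomFree F → (I J : Interp A) → (J ⊨ F) ⇔ (I ⊨ F)
  atomFree-⇔ free I J = mk⇔ (atomFree-⊨ free J I) (atomFree-⊨ free I J)

  atomFree⇒¬AtomIn : ∀ {X F} → AtomFree F → ¬ AtomIn X F
  atomFree⇒¬AtomIn () (atom-in _ _)

  ⊥F-atomFree : AtomFree ⊥F
  ⊥F-atomFree = ⋁-atomFree λ ()

  FT-⊥F-atomFree : ∀ {I R} → FT ⊥F I R → AtomFree R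
  FT-⊥F-atomFree (ft-or _) = ⋁-atomFree λ ()

  data LiteralReduct (I : Interp A) : Formula A → Set₁ where
    atom-reduct     : ∀ {p} → I p ≡ true → LiteralReduct I (atom p)
    atomFree-reduct : ∀ {R} → AtomFree R → LiteralReduct I R

  FT-extendedLiteral : ∀ {L I R} → ExtendedLiteral L → FT L I R → LiteralReduct I R
  FT-extendedLiteral (lit-pos p) (ft-atom-in Ip) = atom-reduct Ip
  FT-extendedLiteral (lit-pos p) (ft-atom-out _) = atomFree-reduct ⊥F-atomFree
  FT-extendedLiteral (lit-neg p) (ft-imp-false _) = atomFree-reduct ⊥F-atomFree
  FT-extendedLiteral (lit-neg p) (ft-imp-true I⊨¬p (ft-atom-in Ip) _) with I⊨¬p Ip
  ... | () , _
  FT-extendedLiteral (lit-neg p) (ft-imp-true _ (ft-atom-out _) ft⊥) =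
    atomFree-reduct (⇒-atomFree ⊥F-atomFree (FT-⊥F-atomFree ft⊥))
  FT-extendedLiteral (lit-negneg p) (ft-imp-false _) = atomFree-reduct ⊥F-atomFree
  FT-extendedLiteral (lit-negneg p) (ft-imp-true I⊨¬¬p (ft-imp-true I⊨¬p _ _) _) with I⊨¬¬p I⊨¬p
  ... | () , _
  FT-extendedLiteral (lit-negneg p) (ft-imp-true _ (ft-imp-false _) ft⊥) =
    atomFree-reduct (⇒-atomFree ⊥F-atomFree (FT-⊥F-atomFree ft⊥))

  ¬AtomIn-∖⇔ : ∀ (I J : Interp A) {p} → I p ≡ true → (¬ AtomIn (I ∖ J) (atom p)) ⇔ (J p ≡ true)
  ¬AtomIn-∖⇔ I J {p} Ip = mk⇔ to from
    where
      to : ¬ AtomIn (I ∖ J) (atom p) → J p ≡ true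
      to p∉I∖J with J p in Jp
      ... | true  = refl
      ... | false = ⊥-elim (p∉I∖J (atom-in p p∈I∖J))
        where
          p∈I∖J : (I ∖ J) p ≡ true
          p∈I∖J rewrite Ip | Jp = refl
      from : J p ≡ true → ¬ AtomIn (I ∖ J) (atom p)
      from Jp (atom-in _ p∈I∖J) rewrite Ip | Jp with p∈I∖J
      ... | ()

  literalReduct-⊨ : ∀ {I} (J : Interp A) {R} → LiteralReduct I R →
                    (J ⊨ R) ⇔ (¬ AtomIn (I ∖ J) R × I ⊨ R)
  literalReduct-⊨ {I} J (atom-reduct Ip) =
    mk⇔ (λ Jp → Equivalence.from (¬AtomIn-∖⇔ I J Ip) Jp , Ip)
        (λ (p∉I∖J , _) → Equivalence.to (¬AtomIn-∖⇔ I J Ip) p∉I∖J)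
  literalReduct-⊨ {I} J (atomFree-reduct free) =
    mk⇔ (λ J⊨R → atomFree⇒¬AtomIn free , Equivalence.to (atomFree-⇔ free I J) J⊨R)
        (λ (_ , I⊨R) → Equivalence.from (atomFree-⇔ free I J) I⊨R)

lemma6 : {A : Set} (G : Formula A) → SimpleDisjunction G →
    (I J : Interp A) (R : Formula A) → FT G I R →
    (J ⊨ R) ⇔ (I ⊨ (R ^ (I ∖ J) ⊥))
lemma6 .(⋁ K L) (simple K L literals) I J .(⋁ K R) (ft-or {R = R} reducts) = mk⇔ to from
  where
    term⇔ : ∀ k → (J ⊨ R k) ⇔ (¬ AtomIn (I ∖ J) (R k) × I ⊨ R k)
    term⇔ k = literalReduct-⊨ J (FT-extendedLiteral (literals k) (reducts k))

    to : J ⊨ ⋁ K R → I ⊨ (⋁ K R ^ (I ∖ J) ⊥)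
    to (k , J⊨Rk) with Equivalence.to (term⇔ k) J⊨Rk
    ... | Rk∉I∖J , I⊨Rk = (k , Rk∉I∖J) , I⊨Rk

    from : I ⊨ (⋁ K R ^ (I ∖ J) ⊥) → J ⊨ ⋁ K R
    from ((k , Rk∉I∖J) , I⊨Rk) = k , Equivalence.from (term⇔ k) (Rk∉I∖J , I⊨Rk)
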